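{- Let $\mathcal L$ be a finite modular lattice equipped with a cover-weighting $w$. Suppose (CW1) and (CW2) hold for every interval of length $2$ in $\mathcal L$. Then $(\mathcal L,w)$ satisfies the interval-weight axioms (IW1) and (IW2). In particular, $(\mathcal L,r_w)$ is an $\mathcal L$-polymatroid, where $r_w(A)=\sum_{i=1}^m w([X_{i-1},X_i])$ for any maximal chain $\mathbf 0=X_0\lessdot\cdots\lessdot X_m=A$.
   Context: A cover-weighting assigns to each cover $A\lessdot B$ of $\mathcal L$ a value $w([A,B])\ge0$. Cover-weight axioms, for an interval $[A,B]$ of length two and $X,Y$ with $A<X<B$, $A<Y<B$: - (CW1) $w([A,X])+w([X,B])=w([A,Y])+w([Y,B])$; - (CW2) $w([A,X])\ge w([Y,B])$ whenever $X\ne Y$. Interval-weight axioms: - (IW1) For every interval $[A,B]$, the sum of $w$ over the covers of a maximal chain from $A$ to $B$ does not depend on the chain; this value is denoted $w([A,B])$. - (IW2) (IW1) holds, and $w([A,X\vee A])\le w([A\wedge X,X])$ for all $A,X$. An $\mathcal L$-polymatroid is a pair $(\mathcal L,r)$ with $r:\mathcal L\to\mathbb R$ such that, for some $t\ge0$, $0\le r(A)\le t\,\mathrm h(A)$ (with $\mathrm h$ the height), $r$ is increasing, and $r(A)-r(A\wedge B)\ge r(A\vee B)-r(B)$ for all $A,B$. -}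

module Defs where

open import Data.Nat using (ℕ; zero; suc)
open import Data.Fin using (Fin)
open import Data.Product using (Σ; _×_; _,_)
open import Data.Sum using (_⊎_)
open import Function.Bundles using (_↔_)
open import Relation.Binary.PropositionalEquality using (_≡_; _≢_)
open import Relation.Binary.Structures using (IsTotalOrder)
open import Relation.Binary.Lattice.Structures using (IsLattice)
open import Algebra.Structures using (IsAbelianGroup)

-- Value domain for weights: a totally ordered abelian group
-- (the real numbers ℝ with + and ≤ are an instance).

record OrderedAbelianGroup : Set₁ where
  infixl 6 _+_ _-_
  infix 4 _≤_
  field
    Carrier        : Set
    _+_            : Carrier → Carrier → Carrier
    0#             : Carrier
    -_             : Carrier → Carrier
    _≤_            : Carrier → Carrier → Set
    isAbelianGroup : IsAbelianGroup _≡_ _+_ 0# -_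
    isTotalOrder   : IsTotalOrder _≡_ _≤_
    +-monoˡ-≤      : ∀ {a b} c → a ≤ b → a + c ≤ b + c

  _-_ : Carrier → Carrier → Carrier
  a - b = a + (- b)

  _·_ : ℕ → Carrier → Carrier
  zero  · a = 0#
  suc n · a = a + (n · a)

record FiniteModularLattice : Set₁ where
  infix 4 _≤_
  infixr 6 _∨_
  infixr 7 _∧_
  field
    Carrier   : Set
    _≤_       : Carrier → Carrier → Set
    _∨_       : Carrier → Carrier → Carrier
    _∧_       : Carrier → Carrier → Carrier
    isLattice : IsLattice _≡_ _≤_ _∨_ _∧_
    size      : ℕ
    finite    : Fin size ↔ Carrier
    𝟎         : Carrier
    𝟎-least   : ∀ x → 𝟎 ≤ x
    modular   : ∀ x y z → x ≤ z → x ∨ (y ∧ z) ≡ (x ∨ y) ∧ z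

  _<_ : Carrier → Carrier → Set
  a < b = a ≤ b × a ≢ b

  infix 4 _⋖_
  _⋖_ : Carrier → Carrier → Set
  a ⋖ b = a < b × (∀ c → a ≤ c → c ≤ b → c ≡ a ⊎ c ≡ b)

  data Chain : Carrier → Carrier → Set where
    done : ∀ {a} → Chain a a
    step : ∀ {a x b} → a ⋖ x → Chain x b → Chain a b

  length : ∀ {a b} → Chain a b → ℕ
  length done       = zero
  length (step _ c) = suc (length c)

module _ (L : FiniteModularLattice) (G : OrderedAbelianGroup) where
  private
    module L = FiniteModularLattice L
    module G = OrderedAbelianGroup G
  open L using (Chain; done; step; _⋖_; _∨_; _∧_; 𝟎)
  open G using (_+_; 0#; _-_; _·_)

  -- a cover-weighting: w A B is the weight of the cover A ⋖ B
  -- (its values on non-covers are irrelevant)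
  record CoverWeighting : Set where
    field
      w      : L.Carrier → L.Carrier → G.Carrier
      w-nonneg : ∀ A B → A ⋖ B → 0# G.≤ w A B

  module _ (cw : CoverWeighting) where
    open CoverWeighting cw

    chainWeight : ∀ {A B} → Chain A B → G.Carrier
    chainWeight done                = 0#
    chainWeight (step {a} {x} _ c) = w a x + chainWeight c

    CW1 : Set
    CW1 = ∀ A X Y B → A ⋖ X → X ⋖ B → A ⋖ Y → Y ⋖ B →
          w A X + w X B ≡ w A Y + w Y B

    CW2 : Set
    CW2 = ∀ A X Y B → A ⋖ X → X ⋖ B → A ⋖ Y → Y ⋖ B → X ≢ Y →
          w Y B G.≤ w A X

    IW1 : Set
    IW1 = ∀ A B (c d : Chain A B) → chainWeight c ≡ chainWeight d

    IW2 : Set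
    IW2 = IW1 × (∀ A X (c : Chain A (X ∨ A)) (d : Chain (A ∧ X) X) →
                 chainWeight c G.≤ chainWeight d)

  -- (L, r) is an L-polymatroid; the height h(A) is the length of a
  -- maximal chain from 𝟎 to A (all such chains have the same length)
  IsPolymatroid : (L.Carrier → G.Carrier) → Set
  IsPolymatroid r =
    Σ G.Carrier λ t → (0# G.≤ t)
      × (∀ A (c : Chain 𝟎 A) → (0# G.≤ r A) × (r A G.≤ (L.length c · t)))
      × (∀ A B → A L.≤ B → r A G.≤ r B)
      × (∀ A B → r (A ∨ B) - r B G.≤ r A - r (A ∧ B))

module Submission where

-- IW1 is a weighted Jordan–Dedekind argument: two maximal chains leaving A through
-- different covers X and Y are compared through X ∨ Y, which covers both by
-- modularity, and (CW1) balances the resulting diamond. For IW2, a maximal chain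
-- from A ∧ X to X is joined with A: each cover either collapses or stays a cover,
-- and its weight cannot grow, since a cover a ⋖ b is carried to a ∨ z ⋖ b ∨ z
-- along a chain from a to a ∨ z by steps that are instances of (CW2). The rank r_w
-- is then monotone by nonnegativity of w and submodular by IW2.

open import Defs
open import Data.Product using (Σ; _×_; _,_; proj₁; proj₂; ∃)
open import Data.Sum using (_⊎_; inj₁; inj₂; [_,_]′)
import Data.Sum as Sum
open import Data.Nat as ℕ using (s≤s)
import Data.Nat.Properties as ℕ
open import Data.Fin.Properties using (any?) renaming (_≟_ to _≟ᶠ_)
open import Data.Fin.Induction using (spo-wellFounded)
open import Data.List using (List; map; allFin)
open import Data.List.Membership.Propositional using (_∈_)
open import Data.List.Membership.Propositional.Properties using (∈-map⁺; ∈-allFin)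
import Data.List.Relation.Unary.All as All
import Data.List.Relation.Unary.All.Properties as All
import Data.List.Extrema as Extrema
open import Function using (_∘_; flip; Inverse)
open import Function.Properties.Inverse using (↔⇒↣; ↔-sym)
open import Induction.WellFounded using (WellFounded; Acc; acc; module Subrelation)
open import Relation.Nullary using (¬_; Dec; yes; no; contradiction)
open import Relation.Nullary.Decidable using (map′; via-injection; _×-dec_)
open import Relation.Binary using (Rel; Decidable; DecidableEquality; IsStrictPartialOrder)
open import Relation.Binary.Bundles using (TotalOrder)
open import Relation.Binary.Lattice using (Lattice)
import Relation.Binary.Construct.On as On
import Relation.Binary.Construct.Flip.EqAndOrd as Flip
import Relation.Binary.Construct.NonStrictToStrict as NonStrictToStrict
import Relation.Binary.Lattice.Properties.JoinSemilattice as JoinSemilatticeProperties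
import Relation.Binary.Lattice.Properties.MeetSemilattice as MeetSemilatticeProperties
import Relation.Binary.Reasoning.PartialOrder as ≤-Reasoning
open import Relation.Binary.PropositionalEquality
  using (_≡_; _≢_; refl; sym; trans; cong; subst; subst₂; module ≡-Reasoning)
open import Algebra.Bundles using (AbelianGroup)
import Algebra.Properties.AbelianGroup as AbelianGroupProperties

module CoverProperties (L : FiniteModularLattice) where
  open FiniteModularLattice L

  lattice : Lattice _ _ _
  lattice = record { isLattice = isLattice }

  open Lattice lattice public
    using (x≤x∨y; y≤x∨y; ∨-least; x∧y≤x; x∧y≤y; ∧-greatest; antisym; isPartialOrder)
    renaming (refl to ≤-refl; trans to ≤-trans; reflexive to ≤-reflexive)
  open JoinSemilatticeProperties (Lattice.joinSemilattice lattice) public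
    using (∨-comm; ∨-assoc; ∨-monotonic; x≤y⇒x∨y≈y; ≈-dec⇒≤-dec)
  open MeetSemilatticeProperties (Lattice.meetSemilattice lattice) public
    using (∧-comm; y≤x⇒x∧y≈y)

  ⋖⇒≤ : ∀ {a b} → a ⋖ b → a ≤ b
  ⋖⇒≤ ((a≤b , _) , _) = a≤b

  ⋖⇒≢ : ∀ {a b} → a ⋖ b → a ≢ b
  ⋖⇒≢ ((_ , a≢b) , _) = a≢b

  ⋖⇒≱ : ∀ {a b} → a ⋖ b → ¬ b ≤ a
  ⋖⇒≱ a⋖b b≤a = ⋖⇒≢ a⋖b (antisym (⋖⇒≤ a⋖b) b≤a)

  ⋖-between : ∀ {a b} → a ⋖ b → ∀ c → a ≤ c → c ≤ b → c ≡ a ⊎ c ≡ b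
  ⋖-between = proj₂

  Chain⇒≤ : ∀ {a b} → Chain a b → a ≤ b
  Chain⇒≤ done         = ≤-refl
  Chain⇒≤ (step a⋖x c) = ≤-trans (⋖⇒≤ a⋖x) (Chain⇒≤ c)

  infixr 5 _++_
  _++_ : ∀ {a b c} → Chain a b → Chain b c → Chain a c
  done       ++ d = d
  step a⋖x c ++ d = step a⋖x (c ++ d)

  x≤y⇒[x∨z]∨y≡y∨z : ∀ {x y} z → x ≤ y → (x ∨ z) ∨ y ≡ y ∨ z
  x≤y⇒[x∨z]∨y≡y∨z {x} {y} z x≤y = begin
    (x ∨ z) ∨ y ≡⟨ cong (_∨ y) (∨-comm x z) ⟩
    (z ∨ x) ∨ y ≡⟨ ∨-assoc z x y ⟩
    z ∨ (x ∨ y) ≡⟨ cong (z ∨_) (x≤y⇒x∨y≈y x≤y) ⟩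
    z ∨ y       ≡⟨ ∨-comm z y ⟩
    y ∨ z       ∎
    where open ≡-Reasoning

  [a∨z]∨[b∧c]≡c : ∀ {a b c} z → a ≤ b → a ∨ z ≤ c → c ≤ b ∨ z → (a ∨ z) ∨ (b ∧ c) ≡ c
  [a∨z]∨[b∧c]≡c {a} {b} {c} z a≤b az≤c c≤bz = begin
    (a ∨ z) ∨ (b ∧ c) ≡⟨ modular (a ∨ z) b c az≤c ⟩
    ((a ∨ z) ∨ b) ∧ c ≡⟨ cong (_∧ c) (x≤y⇒[x∨z]∨y≡y∨z z a≤b) ⟩
    (b ∨ z) ∧ c       ≡⟨ y≤x⇒x∧y≈y c≤bz ⟩
    c                 ∎
    where open ≡-Reasoning

  -- The case is decided by which end of [a, b] the element (a ∨ z) ∧ b is.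
  ⋖⇒∨-≡⊎⋖ : ∀ {a b} → a ⋖ b → ∀ z → a ∨ z ≡ b ∨ z ⊎ a ∨ z ⋖ b ∨ z
  ⋖⇒∨-≡⊎⋖ {a} {b} a⋖b z =
    [ inj₂ ∘ covers , inj₁ ∘ collapses ]′
      (⋖-between a⋖b ((a ∨ z) ∧ b) (∧-greatest (x≤x∨y a z) a≤b) (x∧y≤y _ _))
    where
      a≤b : a ≤ b
      a≤b = ⋖⇒≤ a⋖b

      az≤bz : a ∨ z ≤ b ∨ z
      az≤bz = ∨-monotonic a≤b ≤-refl

      collapses : (a ∨ z) ∧ b ≡ b → a ∨ z ≡ b ∨ z
      collapses m≡b = antisym az≤bz (∨-least b≤az (y≤x∨y a z))
        where
          b≤az : b ≤ a ∨ z
          b≤az = ≤-trans (≤-reflexive (sym m≡b)) (x∧y≤x _ _)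

      covers : (a ∨ z) ∧ b ≡ a → a ∨ z ⋖ b ∨ z
      covers m≡a = (az≤bz , az≢bz) , between
        where
          az≢bz : a ∨ z ≢ b ∨ z
          az≢bz az≡bz =
            ⋖⇒≢ a⋖b (trans (sym m≡a) (trans (cong (_∧ b) az≡bz) (y≤x⇒x∧y≈y (x≤x∨y b z))))

          between : ∀ c → a ∨ z ≤ c → c ≤ b ∨ z → c ≡ a ∨ z ⊎ c ≡ b ∨ z
          between c az≤c c≤bz =
            Sum.map (c≡_∨z ≤-refl) (c≡_∨z a≤b)
                    (⋖-between a⋖b (b ∧ c) (∧-greatest a≤b (≤-trans (x≤x∨y a z) az≤c)) (x∧y≤x b c))
            where
              c≡_∨z : ∀ {u} → a ≤ u → b ∧ c ≡ u → c ≡ u ∨ z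
              c≡_∨z {u} a≤u b∧c≡u = begin
                c                 ≡⟨ [a∨z]∨[b∧c]≡c z a≤b az≤c c≤bz ⟨
                (a ∨ z) ∨ (b ∧ c) ≡⟨ cong ((a ∨ z) ∨_) b∧c≡u ⟩
                (a ∨ z) ∨ u       ≡⟨ x≤y⇒[x∨z]∨y≡y∨z z a≤u ⟩
                u ∨ z             ∎
                where open ≡-Reasoning

  upperCovering : ∀ {a x y} → a ⋖ x → a ⋖ y → x ≢ y → x ⋖ x ∨ y
  upperCovering {a} {x} {y} a⋖x a⋖y x≢y with ⋖⇒∨-≡⊎⋖ a⋖y x
  ... | inj₂ ax⋖yx = subst₂ _⋖_ (x≤y⇒x∨y≈y (⋖⇒≤ a⋖x)) (∨-comm y x) ax⋖yx
  ... | inj₁ ax≡yx with ⋖-between a⋖x y (⋖⇒≤ a⋖y) y≤x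
    where
      y≤x : y ≤ x
      y≤x = ≤-trans (x≤x∨y y x) (≤-reflexive (trans (sym ax≡yx) (x≤y⇒x∨y≈y (⋖⇒≤ a⋖x))))
  ...   | inj₁ y≡a = contradiction (sym y≡a) (⋖⇒≢ a⋖y)
  ...   | inj₂ y≡x = contradiction (sym y≡x) x≢y

module Finiteness (L : FiniteModularLattice) where
  open FiniteModularLattice L
  open CoverProperties L
  open Inverse finite using (to; from; strictlyInverseˡ)

  _≟_ : DecidableEquality Carrier
  _≟_ = via-injection (↔⇒↣ (↔-sym finite)) _≟ᶠ_

  _<?_ : Decidable _<_
  _<?_ = NonStrictToStrict.<-decidable _≡_ _≤_ _≟_ (≈-dec⇒≤-dec _≟_)

  ∃? : ∀ {p} {P : Carrier → Set p} → (∀ x → Dec (P x)) → Dec (∃ P)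
  ∃? {P = P} P? = map′ (λ (i , p) → to i , p)
                       (λ (x , p) → from x , subst P (sym (strictlyInverseˡ x)) p)
                       (any? (P? ∘ to))

  elements : List Carrier
  elements = map to (allFin size)

  ∈-elements : ∀ x → x ∈ elements
  ∈-elements x = subst (_∈ elements) (strictlyInverseˡ x) (∈-map⁺ to (∈-allFin (from x)))

  finite-wellFounded : ∀ {r} {_⊏_ : Rel Carrier r} → IsStrictPartialOrder _≡_ _⊏_ → WellFounded _⊏_
  finite-wellFounded {_⊏_ = _⊏_} ⊏-isSPO =
    Subrelation.wellFounded ⊏⇒⊏-via-Fin
      (On.wellFounded from (spo-wellFounded (On.isStrictPartialOrder to ⊏-isSPO)))
    where
      ⊏⇒⊏-via-Fin : ∀ {x y} → x ⊏ y → to (from x) ⊏ to (from y)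
      ⊏⇒⊏-via-Fin = subst₂ _⊏_ (sym (strictlyInverseˡ _)) (sym (strictlyInverseˡ _))

  <-isStrictPartialOrder : IsStrictPartialOrder _≡_ _<_
  <-isStrictPartialOrder = NonStrictToStrict.<-isStrictPartialOrder _≡_ _≤_ isPartialOrder

  <-wellFounded : WellFounded _<_
  <-wellFounded = finite-wellFounded <-isStrictPartialOrder

  >-wellFounded : WellFounded (flip _<_)
  >-wellFounded = finite-wellFounded (Flip.isStrictPartialOrder <-isStrictPartialOrder)

  <⇒∃⋖ : ∀ {a b} → a < b → ∃ λ x → a ⋖ x × x ≤ b
  <⇒∃⋖ {a} {b} = go b (<-wellFounded b)
    where
      go : ∀ b → Acc _<_ b → a < b → ∃ λ x → a ⋖ x × x ≤ b
      go b (acc below) a<b with ∃? (λ y → (a <? y) ×-dec (y <? b))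
      ... | yes (y , a<y , y<b) =
        let x , a⋖x , x≤y = go y (below y<b) a<y in x , a⋖x , ≤-trans x≤y (proj₁ y<b)
      ... | no ∄a<y<b = b , (a<b , between) , ≤-refl
        where
          between : ∀ c → a ≤ c → c ≤ b → c ≡ a ⊎ c ≡ b
          between c a≤c c≤b with c ≟ a | c ≟ b
          ... | yes c≡a | _       = inj₁ c≡a
          ... | no _    | yes c≡b = inj₂ c≡b
          ... | no c≢a  | no c≢b  = contradiction (c , (a≤c , c≢a ∘ sym) , (c≤b , c≢b)) ∄a<y<b

  maximalChain : ∀ {a b} → a ≤ b → Chain a b
  maximalChain {a} {b} = go a (>-wellFounded a)
    where
      go : ∀ a → Acc (flip _<_) a → a ≤ b → Chain a b
      go a (acc above) a≤b with a ≟ b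
      ... | yes refl = done
      ... | no a≢b   = let x , a⋖x , x≤b = <⇒∃⋖ (a≤b , a≢b) in step a⋖x (go x (above (proj₁ a⋖x)) x≤b)

module OrderedGroupProperties (G : OrderedAbelianGroup) where
  open OrderedAbelianGroup G

  totalOrder : TotalOrder _ _ _
  totalOrder = record { isTotalOrder = isTotalOrder }

  abelianGroup : AbelianGroup _ _
  abelianGroup = record { isAbelianGroup = isAbelianGroup }

  open TotalOrder totalOrder public using (poset)
    renaming (refl to ≤-refl; trans to ≤-trans; reflexive to ≤-reflexive)
  open AbelianGroup abelianGroup public using (identityˡ; identityʳ; comm) renaming (assoc to +-assoc)
  open AbelianGroupProperties abelianGroup public using (xyx⁻¹≈y)
  open Extrema totalOrder public using (max)

  +-monoʳ-≤ : ∀ {a b} c → a ≤ b → c + a ≤ c + b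
  +-monoʳ-≤ {a} {b} c a≤b = subst₂ _≤_ (comm a c) (comm b c) (+-monoˡ-≤ c a≤b)

  +-mono-≤ : ∀ {a b c d} → a ≤ b → c ≤ d → a + c ≤ b + d
  +-mono-≤ {b = b} {c} a≤b c≤d = ≤-trans (+-monoˡ-≤ c a≤b) (+-monoʳ-≤ b c≤d)

  x≤x+y : ∀ x {y} → 0# ≤ y → x ≤ x + y
  x≤x+y x 0≤y = ≤-trans (≤-reflexive (sym (identityʳ x))) (+-monoʳ-≤ x 0≤y)

  x≤y+x : ∀ x {y} → 0# ≤ y → x ≤ y + x
  x≤y+x x {y} 0≤y = ≤-trans (x≤x+y x 0≤y) (≤-reflexive (comm x y))

  +-nonneg : ∀ {x y} → 0# ≤ x → 0# ≤ y → 0# ≤ x + y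
  +-nonneg {x} 0≤x 0≤y = ≤-trans 0≤x (x≤x+y x 0≤y)

  f≤max-map : ∀ {A : Set} (f : A → Carrier) ⊥ {x xs} → x ∈ xs → f x ≤ max ⊥ (map f xs)
  f≤max-map f ⊥ {xs = xs} = All.lookup (All.map⁻ (Extrema.xs≤max totalOrder ⊥ (map f xs)))

module CoverWeightingProperties (L : FiniteModularLattice) (G : OrderedAbelianGroup)
                                (cw : CoverWeighting L G) where
  open FiniteModularLattice L
  open CoverProperties L
  open Finiteness L
  open OrderedAbelianGroup G using (_+_; 0#; _-_; _·_) renaming (Carrier to Value; _≤_ to _≤ᵍ_)
  open OrderedGroupProperties G
    renaming (≤-refl to ≤ᵍ-refl; ≤-trans to ≤ᵍ-trans; ≤-reflexive to ≤ᵍ-reflexive)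
  open CoverWeighting cw

  weight : ∀ {a b} → Chain a b → Value
  weight = chainWeight L G cw

  weight-nonneg : ∀ {a b} (c : Chain a b) → 0# ≤ᵍ weight c
  weight-nonneg done                 = ≤ᵍ-refl
  weight-nonneg (step {a} {x} a⋖x c) = +-nonneg (w-nonneg a x a⋖x) (weight-nonneg c)

  weight-++ : ∀ {a b c} (d : Chain a b) (e : Chain b c) → weight (d ++ e) ≡ weight d + weight e
  weight-++ done                 e = sym (identityˡ (weight e))
  weight-++ (step {a} {x} _ d) e = trans (cong (w a x +_) (weight-++ d e)) (sym (+-assoc _ _ _))

  weight≤length· : ∀ {t} → (∀ a b → w a b ≤ᵍ t) → ∀ {a b} (c : Chain a b) → weight c ≤ᵍ length c · t
  weight≤length· w≤t done               = ≤ᵍ-refl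
  weight≤length· w≤t (step {a} {x} _ c) = +-mono-≤ (w≤t a x) (weight≤length· w≤t c)

  rowBound : Carrier → Value
  rowBound a = max 0# (map (w a) elements)

  weightBound : Value
  weightBound = max 0# (map rowBound elements)

  0≤weightBound : 0# ≤ᵍ weightBound
  0≤weightBound = Extrema.⊥≤max totalOrder 0# (map rowBound elements)

  w≤weightBound : ∀ a b → w a b ≤ᵍ weightBound
  w≤weightBound a b = ≤ᵍ-trans (f≤max-map (w a) 0# (∈-elements b)) (f≤max-map rowBound 0# (∈-elements a))

  module _ (cw1 : CW1 L G cw) where

    -- Jordan–Dedekind comes along: equal lengths make the second recursive call decrease.
    length-and-weight-unique : ∀ n {a b} (c d : Chain a b) → length c ℕ.≤ n →
                               length c ≡ length d × weight c ≡ weight d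
    length-and-weight-unique _ done done _ = refl , refl
    length-and-weight-unique _ done (step a⋖x d) _ = contradiction (Chain⇒≤ d) (⋖⇒≱ a⋖x)
    length-and-weight-unique _ (step a⋖x c) done _ = contradiction (Chain⇒≤ c) (⋖⇒≱ a⋖x)
    length-and-weight-unique (ℕ.suc n) {a} (step {x = x} a⋖x c) (step {x = y} a⋖y d) (s≤s len≤n)
      with x ≟ y
    ... | yes refl = cong ℕ.suc (proj₁ same) , cong (w a x +_) (proj₂ same)
      where
        same : length c ≡ length d × weight c ≡ weight d
        same = length-and-weight-unique n c d len≤n
    ... | no x≢y = cong ℕ.suc (trans (proj₁ viaX) (proj₁ viaY)) , weights
      where
        z : Carrier
        z = x ∨ y
        x⋖z : x ⋖ z
        x⋖z = upperCovering a⋖x a⋖y x≢y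
        y⋖z : y ⋖ z
        y⋖z = subst (y ⋖_) (∨-comm y x) (upperCovering a⋖y a⋖x (x≢y ∘ sym))
        e : Chain z _
        e = maximalChain (∨-least (Chain⇒≤ c) (Chain⇒≤ d))
        viaX : length c ≡ length (step x⋖z e) × weight c ≡ weight (step x⋖z e)
        viaX = length-and-weight-unique n c (step x⋖z e) len≤n
        viaY : length (step y⋖z e) ≡ length d × weight (step y⋖z e) ≡ weight d
        viaY = length-and-weight-unique n (step y⋖z e) d (subst (ℕ._≤ n) (proj₁ viaX) len≤n)
        weights : w a x + weight c ≡ w a y + weight d
        weights = begin
          w a x + weight c           ≡⟨ cong (w a x +_) (proj₂ viaX) ⟩
          w a x + (w x z + weight e) ≡⟨ +-assoc _ _ _ ⟨
          (w a x + w x z) + weight e ≡⟨ cong (_+ weight e) (cw1 a x y z a⋖x x⋖z a⋖y y⋖z) ⟩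
          (w a y + w y z) + weight e ≡⟨ +-assoc _ _ _ ⟩
          w a y + (w y z + weight e) ≡⟨ cong (w a y +_) (proj₂ viaY) ⟩
          w a y + weight d           ∎
          where open ≡-Reasoning

    iw1 : IW1 L G cw
    iw1 _ _ c d = proj₂ (length-and-weight-unique (length c) c d ℕ.≤-refl)

    weight-cong : ∀ {a a′ b} → a ≡ a′ → (c : Chain a b) (c′ : Chain a′ b) → weight c ≡ weight c′
    weight-cong refl = iw1 _ _

    r : Carrier → Value
    r A = weight (maximalChain (𝟎-least A))

    r≡weight : ∀ A (c : Chain 𝟎 A) → r A ≡ weight c
    r≡weight A = iw1 𝟎 A (maximalChain (𝟎-least A))

    r-++ : ∀ {A B} (c : Chain A B) → r B ≡ r A + weight c
    r-++ {A} {B} c = trans (r≡weight B (maximalChain (𝟎-least A) ++ c)) (weight-++ (maximalChain (𝟎-least A)) c)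

    r-difference : ∀ {A B} (c : Chain A B) → r B - r A ≡ weight c
    r-difference {A} c = trans (cong (_- r A) (r-++ c)) (xyx⁻¹≈y (r A) (weight c))

    r-monotone : ∀ A B → A ≤ B → r A ≤ᵍ r B
    r-monotone A B A≤B = ≤ᵍ-trans (x≤x+y (r A) (weight-nonneg c)) (≤ᵍ-reflexive (sym (r-++ c)))
      where
        c : Chain A B
        c = maximalChain A≤B

    module _ (cw2 : CW2 L G cw) where

      -- Pushing the cover y ⋖ y ∨ b up a chain, each step is an instance of (CW2).
      w-⋖-∨-antitone : ∀ {y e} b → Chain y e → y ⋖ y ∨ b → ¬ b ≤ e → w e (e ∨ b) ≤ᵍ w y (y ∨ b)
      w-⋖-∨-antitone b done _ _ = ≤ᵍ-refl
      w-⋖-∨-antitone {y} b (step {x = y₁} y⋖y₁ c) y⋖y∨b b≰e =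
        ≤ᵍ-trans (w-⋖-∨-antitone b c y₁⋖y₁∨b b≰e)
                 (cw2 y (y ∨ b) y₁ (y₁ ∨ b) y⋖y∨b y∨b⋖y₁∨b y⋖y₁ y₁⋖y₁∨b y∨b≢y₁)
        where
          y∨b≢y₁ : y ∨ b ≢ y₁
          y∨b≢y₁ y∨b≡y₁ = b≰e (≤-trans (y≤x∨y y b) (≤-trans (≤-reflexive y∨b≡y₁) (Chain⇒≤ c)))
          [y∨b]∨y₁≡y₁∨b : (y ∨ b) ∨ y₁ ≡ y₁ ∨ b
          [y∨b]∨y₁≡y₁∨b = x≤y⇒[x∨z]∨y≡y∨z b (⋖⇒≤ y⋖y₁)
          y₁⋖y₁∨b : y₁ ⋖ y₁ ∨ b
          y₁⋖y₁∨b = subst (y₁ ⋖_) (trans (∨-comm y₁ (y ∨ b)) [y∨b]∨y₁≡y₁∨b)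
                          (upperCovering y⋖y₁ y⋖y∨b (y∨b≢y₁ ∘ sym))
          y∨b⋖y₁∨b : y ∨ b ⋖ y₁ ∨ b
          y∨b⋖y₁∨b = subst (y ∨ b ⋖_) [y∨b]∨y₁≡y₁∨b (upperCovering y⋖y∨b y⋖y₁ y∨b≢y₁)

      w-⋖-∨-≤ : ∀ {a b} z → a ⋖ b → a ∨ z ⋖ b ∨ z → w (a ∨ z) (b ∨ z) ≤ᵍ w a b
      w-⋖-∨-≤ {a} {b} z a⋖b az⋖bz =
        subst₂ _≤ᵍ_ (cong (w (a ∨ z)) (x≤y⇒[x∨z]∨y≡y∨z z a≤b)) (cong (w a) a∨b≡b)
          (w-⋖-∨-antitone b (maximalChain (x≤x∨y a z)) (subst (a ⋖_) (sym a∨b≡b) a⋖b) b≰az)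
        where
          a≤b : a ≤ b
          a≤b = ⋖⇒≤ a⋖b
          a∨b≡b : a ∨ b ≡ b
          a∨b≡b = x≤y⇒x∨y≈y a≤b
          b≰az : ¬ b ≤ a ∨ z
          b≰az b≤az = ⋖⇒≱ az⋖bz (∨-least b≤az (y≤x∨y a z))

      ∨-chain : ∀ z {p q} (d : Chain p q) → Σ (Chain (p ∨ z) (q ∨ z)) λ c → weight c ≤ᵍ weight d
      ∨-chain z done = done , ≤ᵍ-refl
      ∨-chain z (step {a} {x} a⋖x d) with ∨-chain z d | ⋖⇒∨-≡⊎⋖ a⋖x z
      ... | c , c≤d | inj₁ az≡xz rewrite az≡xz = c , ≤ᵍ-trans c≤d (x≤y+x (weight d) (w-nonneg a x a⋖x))
      ... | c , c≤d | inj₂ az⋖xz = step az⋖xz c , +-mono-≤ (w-⋖-∨-≤ z a⋖x az⋖xz) c≤d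

      iw2 : IW2 L G cw
      iw2 = iw1 , λ A X c d →
        let c′ , c′≤d = ∨-chain A d
        in ≤ᵍ-trans (≤ᵍ-reflexive (weight-cong (sym (x≤y⇒x∨y≈y (x∧y≤x A X))) c c′)) c′≤d

      r-submodular : ∀ A B → r (A ∨ B) - r B ≤ᵍ r A - r (A ∧ B)
      r-submodular A B = begin
        r (A ∨ B) - r B     ≡⟨ r-difference B→A∨B ⟩
        weight B→A∨B        ≤⟨ proj₂ iw2 B A B→A∨B B∧A→A ⟩
        weight B∧A→A        ≡⟨ r-difference B∧A→A ⟨
        r A - r (B ∧ A)     ≡⟨ cong (λ m → r A - r m) (∧-comm B A) ⟩
        r A - r (A ∧ B)     ∎
        where
          open ≤-Reasoning poset
          B→A∨B : Chain B (A ∨ B)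
          B→A∨B = maximalChain (y≤x∨y A B)
          B∧A→A : Chain (B ∧ A) A
          B∧A→A = maximalChain (x∧y≤y B A)

      r-isPolymatroid : IsPolymatroid L G r
      r-isPolymatroid =
          weightBound
        , 0≤weightBound
        , (λ A c → weight-nonneg (maximalChain (𝟎-least A))
                 , ≤ᵍ-trans (≤ᵍ-reflexive (r≡weight A c)) (weight≤length· w≤weightBound c))
        , r-monotone
        , r-submodular

theorem3p6 : (L : FiniteModularLattice) (G : OrderedAbelianGroup)
    (cw : CoverWeighting L G) →
    CW1 L G cw → CW2 L G cw →
    IW1 L G cw × IW2 L G cw
      × Σ (FiniteModularLattice.Carrier L → OrderedAbelianGroup.Carrier G) (λ r →
          (∀ A (c : FiniteModularLattice.Chain L (FiniteModularLattice.𝟎 L) A) →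
             r A ≡ chainWeight L G cw c)
          × IsPolymatroid L G r)
theorem3p6 L G cw cw1 cw2 =
  iw1 cw1 , iw2 cw1 cw2 , r cw1 , r≡weight cw1 , r-isPolymatroid cw1 cw2
  where open CoverWeightingProperties L G cw
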